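{- Let $\xi$ be an address and $n\in\mathbb N$. If $\mathfrak p$ is a path of some design of $\mathbb L_n$, then $\widetilde{\mathfrak p}$ is a chronicle, hence a path.
   Context: Ludics: actions are $(+,\xi,I)$, $(-,\xi,I)$ (address a finite sequence of naturals, $I$ finite set of naturals) or the positive daimon $\maltese$; an action on $\xi.i$ is justified by an action of opposite polarity on $\xi$ whose ramification contains $i$; an action is initial if its address is in the base. Chronicles: nonempty finite alternating sequences on a base, each proper action initial or justified by an earlier one, non-initial negative actions justified by the immediately preceding action, distinct addresses, $\maltese$ only last. View: $\ulcorner\epsilon\urcorner=\epsilon$, $\ulcorner\kappa\urcorner=\kappa$, $\ulcorner w\kappa^+\urcorner=\ulcorner w\urcorner\kappa^+$, $\ulcorner w\kappa^-\urcorner=\ulcorner w_0\urcorner\kappa^-$ with $w_0$ empty if $\kappa^-$ initial, else the prefix of $w$ ending with the justifier of $\kappa^-$. A path is a finite alternating sequence of actions on a base, each proper action initial or justified by an earlier one, each justified positive action having its justifier in the view of the preceding prefix, distinct addresses, $\maltese$ only last, nonempty starting positively for a positive base; it is a path of a design $\mathfrak D$ if the views of all nonempty prefixes are chronicles of $\mathfrak D$. Duals: $\overline{\mathfrak p}$ flips polarities; $\widetilde{w\kappa^+}=\overline{w\kappa^+}\maltese$ (proper positive $\kappa^+$), $\widetilde{w\kappa^- }=\overline{w\kappa^- }$, $\widetilde{w\maltese}=\overline w$. Lists: $\mathbf 0_\tau=\{(+,\tau,\emptyset)\}$, $(\mathbf{k+1})_\tau$ the prefix closure of $\{(+,\tau,\{0\})(-,\tau.0,\{1\})\mathfrak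 c\mid\mathfrak c\in\mathbf k_{\tau.0.1}\}$; $\mathfrak D^{\epsilon}_\xi=\{(+,\xi,\emptyset)\}$, and for $n>0$, $\mathfrak D^{\langle a_1,\dots,a_n\rangle}_\xi$ is the prefix closure of $\{(+,\xi,\{0,1\})(-,\xi.0,\{1\})\mathfrak c\mid\mathfrak c\in(\mathbf a_1)_{\xi.0.1}\}\cup\{(+,\xi,\{0,1\})(-,\xi.1,\{1\})\mathfrak c\mid\mathfrak c\in\mathfrak D^{\langle a_2,\dots,a_n\rangle}_{\xi.1.1}\}$; $\mathbb L_n=\{\mathfrak D^{\langle a_1,\dots,a_n\rangle}_\xi\mid a_i\in\mathbb N\}$. -}

module Defs where

open import Data.Nat using (ℕ; zero; suc)
open import Data.Nat.Properties using () renaming (_≟_ to _≟ℕ_)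
open import Data.Bool using (Bool; true; false; _∧_; not; if_then_else_; T)
open import Data.List using (List; []; _∷_; _++_; [_]; reverse; map; length)
open import Data.Bool.ListAction using (any)
open import Data.List.Properties using (≡-dec)
open import Data.List.Membership.Propositional using (_∈_)
open import Data.List.Relation.Unary.Any using (Any)
open import Data.List.Relation.Unary.Unique.Propositional using (Unique)
open import Data.List.Relation.Binary.Pointwise using (Pointwise)
open import Data.Product using (Σ; _×_; _,_; ∃; ∃-syntax)
open import Data.Sum using (_⊎_)
open import Data.Unit using (⊤)
open import Data.Empty using (⊥)
open import Relation.Nullary using (¬_)
open import Relation.Nullary.Decidable using (⌊_⌋)
open import Relation.Binary.PropositionalEquality using (_≡_; _≢_)

Address : Set
Address = List ℕ

_∙_ : Address → ℕ → Address
ξ ∙ i = ξ ++ [ i ]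

_≟A_ : (ξ ζ : Address) → _
_≟A_ = ≡-dec _≟ℕ_

data Pol : Set where
  + - : Pol

_==P_ : Pol → Pol → Bool
+ ==P + = true
- ==P - = true
_ ==P _ = false

flipPol : Pol → Pol
flipPol + = -
flipPol - = +

-- A ramification (finite set of naturals) is represented by a list; all
-- notions below only use membership in it, and designs are taken up to
-- the equivalence _≈A_ identifying ramifications with the same elements.
data Action : Set where
  act    : Pol → Address → List ℕ → Action
  daimon : Action

polOf : Action → Pol
polOf (act p _ _) = p
polOf daimon      = +

Proper : Action → Set
Proper (act _ _ _) = ⊤
Proper daimon      = ⊥

properAddrs : List Action → List Address
properAddrs []                 = []
properAddrs (act _ ξ _ ∷ w)    = ξ ∷ properAddrs w
properAddrs (daimon ∷ w)       = properAddrs w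

_≈A_ : Action → Action → Set
act p ξ I ≈A act q ζ J = p ≡ q × ξ ≡ ζ × ((i : ℕ) → (i ∈ I → i ∈ J) × (i ∈ J → i ∈ I))
daimon    ≈A daimon    = ⊤
_         ≈A _         = ⊥

-- Bases (here: a single address, on the right (positive) or left (negative))

record Base : Set where
  constructor base
  field
    bpol  : Pol
    baddr : Address

posBase : Address → Base
posBase ξ = base + ξ

negBase : Address → Base
negBase ξ = base - ξ

initialB : Base → Action → Bool
initialB (base p ξ) (act q ζ _) = (p ==P q) ∧ ⌊ ζ ≟A ξ ⌋
initialB _          daimon      = false

Initial : Base → Action → Set
Initial b κ = T (initialB b κ)

justifiesB : Action → Action → Bool
justifiesB (act p ξ I) (act q ζ _) = not (p ==P q) ∧ any (λ i → ⌊ ζ ≟A (ξ ∙ i) ⌋) I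
justifiesB _ _ = false

Justifies : Action → Action → Set
Justifies a κ = T (justifiesB a κ)

module _ (b : Base) where
  mutual
    viewR : List Action → List Action
    viewR []                = []
    viewR (daimon ∷ w)      = daimon ∷ viewR w
    viewR (act + ξ I ∷ w)   = act + ξ I ∷ viewR w
    viewR (act - ξ I ∷ w)   =
      if initialB b (act - ξ I) then [ act - ξ I ] else (act - ξ I ∷ seek (act - ξ I) w)

    seek : Action → List Action → List Action
    seek κ []      = []
    seek κ (a ∷ w) = if justifiesB a κ then viewR (a ∷ w) else seek κ w

  view : List Action → List Action
  view w = reverse (viewR (reverse w))

Alternating : List Action → Set
Alternating p = ∀ w a c r → p ≡ w ++ a ∷ c ∷ r → polOf a ≢ polOf c

DaimonLast : List Action → Set
DaimonLast p = ∀ w r → p ≡ w ++ daimon ∷ r → r ≡ []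

DistinctAddrs : List Action → Set
DistinctAddrs p = Unique (properAddrs p)

Justified : Base → List Action → Set
Justified b p = ∀ w κ r → p ≡ w ++ κ ∷ r → Proper κ →
  Initial b κ ⊎ Any (λ a → Justifies a κ) w

StartsWith : Pol → List Action → Set
StartsWith s []      = ⊥
StartsWith s (a ∷ _) = polOf a ≡ s

record Chronicle (b : Base) (c : List Action) : Set where
  field
    startsWithBasePol : StartsWith (Base.bpol b) c
    alternating       : Alternating c
    justified         : Justified b c
    negJustifiedByPrev : ∀ w a κ r → c ≡ w ++ a ∷ κ ∷ r →
      Proper κ → polOf κ ≡ - → ¬ Initial b κ → Justifies a κ
    distinct          : DistinctAddrs c
    daimonLast        : DaimonLast c

record Path (b : Base) (p : List Action) : Set where
  field
    alternating : Alternating p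
    justified   : Justified b p
    posJustifierInView : ∀ w κ r → p ≡ w ++ κ ∷ r → Proper κ → polOf κ ≡ + →
      ¬ Initial b κ → Any (λ a → Justifies a κ) (view b w)
    distinct    : DistinctAddrs p
    daimonLast  : DaimonLast p
    positiveStart : Base.bpol b ≡ + → StartsWith + p

-- a design is given as its set of chronicles
Design : Set₁
Design = List Action → Set

PathOf : Base → Design → List Action → Set
PathOf b D p = Path b p × (∀ w r → p ≡ w ++ r → w ≢ [] → D (view b w))

flipAct : Action → Action
flipAct (act p ξ I) = act (flipPol p) ξ I
flipAct daimon      = daimon

bar : List Action → List Action
bar = map flipAct

tildeR : List Action → List Action
tildeR []                = []
tildeR (daimon ∷ w)      = reverse (bar w)
tildeR (act + ξ I ∷ w)   = reverse (bar (act + ξ I ∷ w)) ++ [ daimon ]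
tildeR (act - ξ I ∷ w)   = reverse (bar (act - ξ I ∷ w))

tilde : List Action → List Action
tilde p = tildeR (reverse p)

Prefix : List Action → List Action → Set
Prefix p q = ∃[ r ] p ++ r ≡ q

PC : (List Action → Set) → List Action → Set
PC S p = ∃[ q ] S q × Prefix p q

-- Numbers k_τ and lists D^{⟨a1..an⟩}_ξ  (raw, with canonical ramifications)

NumD : ℕ → Address → List Action → Set
NumD zero    τ c = c ≡ [ act + τ [] ]
NumD (suc k) τ c = PC (λ q → ∃[ c' ] NumD k ((τ ∙ 0) ∙ 1) c' ×
                              q ≡ act + τ (0 ∷ []) ∷ act - (τ ∙ 0) (1 ∷ []) ∷ c') c

ListDraw : List ℕ → Address → List Action → Set
ListDraw []       ξ c = c ≡ [ act + ξ [] ]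
ListDraw (a ∷ as) ξ c = PC (λ q →
     (∃[ c' ] NumD a ((ξ ∙ 0) ∙ 1) c' ×
              q ≡ act + ξ (0 ∷ 1 ∷ []) ∷ act - (ξ ∙ 0) (1 ∷ []) ∷ c')
   ⊎ (∃[ c' ] ListDraw as ((ξ ∙ 1) ∙ 1) c' ×
              q ≡ act + ξ (0 ∷ 1 ∷ []) ∷ act - (ξ ∙ 1) (1 ∷ []) ∷ c')) c

ListDesign : List ℕ → Address → Design
ListDesign as ξ c = ∃[ q ] ListDraw as ξ q × Pointwise _≈A_ c q

module Submission where

-- Every chronicle of D^{⟨a₁,…,aₙ⟩}_ξ is "linked": its actions are proper and
-- each positive action is justified by the action immediately before it
-- (the designs are built from the spines (+,τ,I)(-,τ.i,{1})… ).  This is the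
-- only property of the lists the proof uses, so the theorem is proved for
-- an arbitrary design D on  ⊢ ξ  whose chronicles are linked:
--   * a path p of D has linked views on all its prefixes; hence p contains
--     no daimon and each positive action of p is justified by its predecessor;
--   * by distinctness of addresses only the first action of p is initial;
--   * the dual  ~p  is  p  with polarities flipped (plus a final daimon when p
--     ends positively), so in  ~p  every negative action is non-initial and
--     justified by its predecessor, which makes every prefix of  ~p  its own
--     view; the chronicle and path conditions on  ~p  then transfer from p.
-- The file proves, in order: facts about dualising single actions, linked
-- sequences and the linkedness of the list designs, views, paths of linked
-- designs, the shape of duals, and finally the theorem.

open import Defs
open import Data.Vec using (Vec; toList)
open import Data.Nat using (ℕ; zero; suc)
open import Data.Bool using (true; false; not)
open import Data.List using (List; []; _∷_; _++_; [_]; _∷ʳ_; reverse; initLast; _∷ʳ′_)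
open import Data.List.Properties
  using (++-assoc; ++-identityʳ; ∷-injective; ∷ʳ-injectiveʳ; reverse-++; unfold-reverse;
         reverse-involutive; reverse-map)
open import Data.List.Membership.Propositional using (_∈_)
open import Data.List.Relation.Unary.Any using (Any; here; there)
import Data.List.Relation.Unary.Any as Any
open import Data.List.Relation.Unary.Any.Properties using (any⁺; any⁻; map⁺)
open import Data.List.Relation.Binary.Subset.Propositional.Properties using (Any-resp-⊆)
import Data.List.Relation.Unary.All as All
open import Data.List.Relation.Unary.AllPairs using (_∷_)
open import Data.List.Relation.Unary.Unique.Propositional using (Unique)
open import Data.List.Relation.Binary.Pointwise using (Pointwise; []; _∷_)
open import Data.Product using (_×_; _,_; ∃-syntax; proj₁; proj₂)
open import Data.Sum using (inj₁; inj₂)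
open import Data.Unit using (⊤; tt)
open import Data.Empty using (⊥; ⊥-elim)
open import Relation.Nullary using (¬_)
open import Relation.Nullary.Decidable using (fromWitness; toWitness)
open import Relation.Binary.PropositionalEquality
  using (_≡_; _≢_; refl; sym; trans; cong; cong₂; subst; module ≡-Reasoning)

flipPol-injective : ∀ {p q} → flipPol p ≡ flipPol q → p ≡ q
flipPol-injective { + } { + } _ = refl
flipPol-injective { - } { - } _ = refl

polOf-flipAct : ∀ κ → Proper κ → polOf (flipAct κ) ≡ flipPol (polOf κ)
polOf-flipAct (act _ _ _) _ = refl

proper-unflip : ∀ κ → Proper (flipAct κ) → Proper κ
proper-unflip (act _ _ _) _ = tt

daimon-unflip : ∀ κ → flipAct κ ≡ daimon → κ ≡ daimon
daimon-unflip daimon _ = refl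

==P-flip : ∀ p q → (flipPol p ==P flipPol q) ≡ (p ==P q)
==P-flip + + = refl
==P-flip + - = refl
==P-flip - + = refl
==P-flip - - = refl

-- Justification only compares polarities, so it is invariant under dualisation.
justifies-flip : ∀ a κ → Justifies a κ → Justifies (flipAct a) (flipAct κ)
justifies-flip (act p _ _) (act q _ _) j rewrite ==P-flip p q = j

initialB-flip : ∀ ξ q ζ I →
  initialB (negBase ξ) (flipAct (act q ζ I)) ≡ initialB (posBase ξ) (act q ζ I)
initialB-flip ξ + ζ I = refl
initialB-flip ξ - ζ I = refl

initial-flip : ∀ ξ κ → Initial (posBase ξ) κ → Initial (negBase ξ) (flipAct κ)
initial-flip ξ (act q ζ I) init rewrite initialB-flip ξ q ζ I = init

initial-unflip : ∀ ξ κ → Initial (negBase ξ) (flipAct κ) → Initial (posBase ξ) κ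
initial-unflip ξ (act q ζ I) init rewrite initialB-flip ξ q ζ I = init

initial-posBase : ∀ ξ q ζ I → Initial (posBase ξ) (act q ζ I) → q ≡ + × ζ ≡ ξ
initial-posBase ξ + ζ I init = refl , toWitness init

Linked : List Action → Set
Linked []          = ⊤
Linked (a ∷ [])    = Proper a
Linked (a ∷ κ ∷ r) = Proper a × (polOf κ ≡ + → Justifies a κ) × Linked (κ ∷ r)

linked-tail : ∀ a l → Linked (a ∷ l) → Linked l
linked-tail a []      _           = tt
linked-tail a (κ ∷ r) (_ , _ , l) = l

linked-suffix : ∀ u v → Linked (u ++ v) → Linked v
linked-suffix []      v l = l
linked-suffix (a ∷ u) v l = linked-suffix u v (linked-tail a (u ++ v) l)

linked-prefix : ∀ u {v} → Linked (u ++ v) → Linked u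
linked-prefix []          _           = tt
linked-prefix (a ∷ [])    {[]}    l   = l
linked-prefix (a ∷ [])    {_ ∷ _} (pa , _) = pa
linked-prefix (a ∷ κ ∷ u) (pa , j , l) = pa , j , linked-prefix (κ ∷ u) l

polOf-resp-≈ : ∀ {κ κ'} → κ ≈A κ' → polOf κ ≡ polOf κ'
polOf-resp-≈ {act _ _ _} {act _ _ _} (refl , _) = refl
polOf-resp-≈ {daimon}    {daimon}    _          = refl

proper-resp-≈ : ∀ {κ κ'} → κ ≈A κ' → Proper κ' → Proper κ
proper-resp-≈ {act _ _ _} _ _ = tt
proper-resp-≈ {daimon} {act _ _ _} () _
proper-resp-≈ {daimon} {daimon}    _  ()

justifies-resp-≈ : ∀ {a a' κ κ'} → a ≈A a' → κ ≈A κ' → Justifies a' κ' → Justifies a κ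
justifies-resp-≈ {act p ξ I} {act _ _ J} {act q ζ _} {act _ _ _}
                 (refl , refl , I≈J) (refl , refl , _) j
  with not (p ==P q)
... | true = any⁺ _ (Any-resp-⊆ (λ {i} → proj₂ (I≈J i)) (any⁻ _ J j))

linked-resp-≈ : ∀ {c q} → Pointwise _≈A_ c q → Linked q → Linked c
linked-resp-≈ []                      _            = tt
linked-resp-≈ (a≈ ∷ [])               pa           = proper-resp-≈ a≈ pa
linked-resp-≈ (a≈ ∷ κ≈ ∷ rest) (pa , j , l) =
    proper-resp-≈ a≈ pa
  , (λ κ⁺ → justifies-resp-≈ a≈ κ≈ (j (trans (sym (polOf-resp-≈ κ≈)) κ⁺)))
  , linked-resp-≈ (κ≈ ∷ rest) l

StartsAt : Address → List Action → Set
StartsAt τ []      = ⊤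
StartsAt τ (a ∷ _) = ∃[ I ] a ≡ act + τ I

negative-justifies-child : ∀ σ I J {i} → i ∈ I → Justifies (act - σ I) (act + (σ ∙ i) J)
negative-justifies-child σ I J i∈I = any⁺ _ (Any.map (λ { refl → fromWitness refl }) i∈I)

linked-spine : ∀ τ I σ c' → Linked c' → StartsAt (σ ∙ 1) c' →
  Linked (act + τ I ∷ act - σ (1 ∷ []) ∷ c')
linked-spine τ I σ []      _   _          = tt , (λ ()) , tt
linked-spine τ I σ (_ ∷ _) lc' (J , refl) =
  tt , (λ ()) , tt , (λ _ → negative-justifies-child σ (1 ∷ []) J (here refl)) , lc'

-- Prefixes of such a sequence are linked and start at τ: this is the
-- inductive step for both  k_τ  and  D^{as}_ξ , which are prefix closures.
linked-branch : ∀ τ I σ {c c'} → Linked c' × StartsAt (σ ∙ 1) c' →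
  Prefix c (act + τ I ∷ act - σ (1 ∷ []) ∷ c') → Linked c × StartsAt τ c
linked-branch τ I σ {[]}    _          _         = tt , tt
linked-branch τ I σ {a ∷ u} {c'} (lc' , sc') (r , a∷u++r≡q) with ∷-injective a∷u++r≡q
... | refl , u++r≡q =
  linked-prefix (a ∷ u) (subst (λ l → Linked (a ∷ l)) (sym u++r≡q) (linked-spine τ I σ c' lc' sc'))
  , (I , refl)

numD-linked : ∀ k τ {c} → NumD k τ c → Linked c × StartsAt τ c
numD-linked zero    τ refl = tt , ([] , refl)
numD-linked (suc k) τ (_ , (_ , d , refl) , pre) =
  linked-branch τ _ (τ ∙ 0) (numD-linked k _ d) pre

listDraw-linked : ∀ as ξ {c} → ListDraw as ξ c → Linked c × StartsAt ξ c
listDraw-linked []       ξ refl = tt , ([] , refl)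
listDraw-linked (a ∷ as) ξ (_ , inj₁ (_ , d , refl) , pre) =
  linked-branch ξ _ (ξ ∙ 0) (numD-linked a _ d) pre
listDraw-linked (a ∷ as) ξ (_ , inj₂ (_ , d , refl) , pre) =
  linked-branch ξ _ (ξ ∙ 1) (listDraw-linked as _ d) pre

listDesign-linked : ∀ as ξ c → ListDesign as ξ c → Linked c
listDesign-linked as ξ c (_ , d , c≈q) = linked-resp-≈ c≈q (proj₁ (listDraw-linked as ξ d))

-- Views.  viewR works on the reversed sequence, so the last action of a
-- sequence is the head of the list viewR is applied to.

viewR-head : ∀ b a l → ∃[ u ] viewR b (a ∷ l) ≡ a ∷ u
viewR-head b daimon      l = _ , refl
viewR-head b (act + ξ I) l = _ , refl
viewR-head b (act - ξ I) l with initialB b (act - ξ I)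
... | true  = _ , refl
... | false = _ , refl

viewR-positive : ∀ b κ l → polOf κ ≡ + → viewR b (κ ∷ l) ≡ κ ∷ viewR b l
viewR-positive b daimon      l _ = refl
viewR-positive b (act + ξ I) l _ = refl

view-last : ∀ b w a → ∃[ u ] view b (w ∷ʳ a) ≡ u ∷ʳ a
view-last b w a with viewR-head b a (reverse w)
... | u , head-eq = reverse u , (begin
  reverse (viewR b (reverse (w ∷ʳ a))) ≡⟨ cong (λ l → reverse (viewR b l)) (reverse-++ w [ a ]) ⟩
  reverse (viewR b (a ∷ reverse w))    ≡⟨ cong reverse head-eq ⟩
  reverse (a ∷ u)                      ≡⟨ unfold-reverse a u ⟩
  reverse u ∷ʳ a                       ∎)
  where open ≡-Reasoning

view-snoc-positive : ∀ b w κ → polOf κ ≡ + → view b (w ∷ʳ κ) ≡ view b w ∷ʳ κ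
view-snoc-positive b w κ κ⁺ = begin
  reverse (viewR b (reverse (w ∷ʳ κ))) ≡⟨ cong (λ l → reverse (viewR b l)) (reverse-++ w [ κ ]) ⟩
  reverse (viewR b (κ ∷ reverse w))    ≡⟨ cong reverse (viewR-positive b κ (reverse w) κ⁺) ⟩
  reverse (κ ∷ viewR b (reverse w))    ≡⟨ unfold-reverse κ (viewR b (reverse w)) ⟩
  view b w ∷ʳ κ                        ∎
  where open ≡-Reasoning

snoc-nonempty : ∀ (w : List Action) a → w ∷ʳ a ≢ []
snoc-nonempty []      a ()
snoc-nonempty (_ ∷ _) a ()

snoc-split : ∀ (w : List Action) a r → w ++ a ∷ r ≡ (w ∷ʳ a) ++ r
snoc-split w a r = sym (++-assoc w [ a ] r)

-- Paths of a design all of whose chronicles are linked (on any base):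
-- since the views of their prefixes are linked, they contain no daimon and
-- each of their positive actions is justified by the action just before it.
module LinkedPath (b : Base) (D : Design) (linked : ∀ c → D c → Linked c)
                  (p : List Action) (P : PathOf b D p) where

  view-linked : ∀ w r → p ≡ w ++ r → w ≢ [] → Linked (view b w)
  view-linked w r p≡w++r w≢[] = linked _ (proj₂ P w r p≡w++r w≢[])

  daimon-free : ∀ w r → p ≡ w ++ daimon ∷ r → ⊥
  daimon-free w r p≡ with view-last b w daimon
  ... | u , view-eq = linked-suffix u [ daimon ]
    (subst Linked view-eq (view-linked (w ∷ʳ daimon) r (trans p≡ (snoc-split w daimon r))
                                         (snoc-nonempty w daimon)))

  proper-at : ∀ w κ r → p ≡ w ++ κ ∷ r → Proper κ
  proper-at w (act _ _ _) r _  = tt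
  proper-at w daimon      r p≡ = daimon-free w r p≡

  positive-justified-by-previous : ∀ w a κ r → p ≡ w ++ a ∷ κ ∷ r → polOf κ ≡ + → Justifies a κ
  positive-justified-by-previous w a κ r p≡ κ⁺ with view-last b w a
  ... | u , view-eq = proj₁ (proj₂ (linked-suffix u (a ∷ κ ∷ [])
    (subst Linked view-eq' (view-linked ((w ∷ʳ a) ∷ʳ κ) r p≡' (snoc-nonempty (w ∷ʳ a) κ))))) κ⁺
    where
    p≡' : p ≡ ((w ∷ʳ a) ∷ʳ κ) ++ r
    p≡' = trans p≡ (trans (snoc-split w a (κ ∷ r)) (snoc-split (w ∷ʳ a) κ r))
    view-eq' : view b ((w ∷ʳ a) ∷ʳ κ) ≡ u ++ a ∷ κ ∷ []
    view-eq' = trans (view-snoc-positive b (w ∷ʳ a) κ κ⁺)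
                     (trans (cong (_∷ʳ κ) view-eq) (++-assoc u [ a ] [ κ ]))

NegativesLinked : Base → List Action → Set
NegativesLinked b t = ∀ w a κ r → t ≡ w ++ a ∷ κ ∷ r → polOf κ ≡ - → ¬ Initial b κ × Justifies a κ

viewR-step : ∀ b κ l → (∀ a l' → l ≡ a ∷ l' → polOf κ ≡ - → ¬ Initial b κ × Justifies a κ) →
  viewR b (κ ∷ l) ≡ κ ∷ viewR b l
viewR-step b daimon      l _ = refl
viewR-step b (act + ζ I) l _ = refl
viewR-step b (act - ζ I) [] _ with initialB b (act - ζ I)
... | true  = refl
... | false = refl
viewR-step b (act - ζ I) (a ∷ l) h = justified-step (proj₁ (h a l refl refl)) (proj₂ (h a l refl refl))
  where
  justified-step : ¬ Initial b (act - ζ I) → Justifies a (act - ζ I) →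
    viewR b (act - ζ I ∷ a ∷ l) ≡ act - ζ I ∷ viewR b (a ∷ l)
  justified-step ¬init j with initialB b (act - ζ I)
  ... | true  = ⊥-elim (¬init tt)
  ... | false with justifiesB a (act - ζ I) | j
  ...   | true | _ = refl

viewR-self : ∀ b l → (∀ u κ a v → l ≡ u ++ κ ∷ a ∷ v → polOf κ ≡ - → ¬ Initial b κ × Justifies a κ) →
  viewR b l ≡ l
viewR-self b []      _ = refl
viewR-self b (κ ∷ l) h =
  trans (viewR-step b κ l (λ a l' l≡ → h [] κ a l' (cong (κ ∷_) l≡)))
        (cong (κ ∷_) (viewR-self b l (λ u κ' a v l≡ → h (κ ∷ u) κ' a v (cong (κ ∷_) l≡))))

reverse-split : ∀ (w u v : List Action) κ a → reverse w ≡ u ++ κ ∷ a ∷ v →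
  w ≡ reverse v ++ a ∷ κ ∷ reverse u
reverse-split w u v κ a rw≡ = begin
  w                                  ≡⟨ sym (reverse-involutive w) ⟩
  reverse (reverse w)                ≡⟨ cong reverse rw≡ ⟩
  reverse (u ++ κ ∷ a ∷ v)           ≡⟨ reverse-++ u (κ ∷ a ∷ v) ⟩
  reverse (κ ∷ a ∷ v) ++ reverse u   ≡⟨ cong (_++ reverse u) (reverse-++ (κ ∷ a ∷ []) v) ⟩
  (reverse v ++ a ∷ κ ∷ []) ++ reverse u ≡⟨ ++-assoc (reverse v) (a ∷ κ ∷ []) (reverse u) ⟩
  reverse v ++ a ∷ κ ∷ reverse u     ∎
  where open ≡-Reasoning

view-prefix-self : ∀ b t → NegativesLinked b t → ∀ w r → t ≡ w ++ r → view b w ≡ w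
view-prefix-self b t neg w r t≡ =
  trans (cong reverse (viewR-self b (reverse w) reversed-linked)) (reverse-involutive w)
  where
  reversed-linked : ∀ u κ a v → reverse w ≡ u ++ κ ∷ a ∷ v → polOf κ ≡ - →
    ¬ Initial b κ × Justifies a κ
  reversed-linked u κ a v rw≡ = neg (reverse v) a κ (reverse u ++ r)
    (trans t≡ (trans (cong (_++ r) (reverse-split w u v κ a rw≡))
                     (++-assoc (reverse v) (a ∷ κ ∷ reverse u) r)))

daimonIfPositive : Pol → List Action
daimonIfPositive + = [ daimon ]
daimonIfPositive - = []

tildeR-proper : ∀ s ζ I m →
  tildeR (act s ζ I ∷ m) ≡ reverse (bar (act s ζ I ∷ m)) ++ daimonIfPositive s
tildeR-proper + ζ I m = refl
tildeR-proper - ζ I m = sym (++-identityʳ _)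

reverse-bar-reverse : ∀ l → reverse (bar (reverse l)) ≡ bar l
reverse-bar-reverse l = trans (cong reverse (reverse-map flipAct l)) (reverse-involutive (bar l))

tilde-last : ∀ p₀ s ζ I →
  tilde (p₀ ∷ʳ act s ζ I) ≡ bar (p₀ ∷ʳ act s ζ I) ++ daimonIfPositive s
tilde-last p₀ s ζ I = begin
  tildeR (reverse p)                     ≡⟨ cong tildeR rev-eq ⟩
  tildeR (κ ∷ reverse p₀)                ≡⟨ tildeR-proper s ζ I (reverse p₀) ⟩
  reverse (bar (κ ∷ reverse p₀)) ++ e    ≡⟨ cong (λ l → reverse (bar l) ++ e) (sym rev-eq) ⟩
  reverse (bar (reverse p)) ++ e         ≡⟨ cong (_++ e) (reverse-bar-reverse p) ⟩
  bar p ++ e                             ∎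
  where
  open ≡-Reasoning
  κ = act s ζ I
  p = p₀ ∷ʳ κ
  e = daimonIfPositive s
  rev-eq : reverse p ≡ κ ∷ reverse p₀
  rev-eq = reverse-++ p₀ [ κ ]

daimonIfPositive-split : ∀ s w κ r → daimonIfPositive s ≡ w ++ κ ∷ r →
  s ≡ + × κ ≡ daimon × r ≡ []
daimonIfPositive-split + []          κ r refl = refl , refl , refl
daimonIfPositive-split + (_ ∷ [])    κ r ()
daimonIfPositive-split + (_ ∷ _ ∷ _) κ r ()
daimonIfPositive-split - []          κ r ()
daimonIfPositive-split - (_ ∷ _)     κ r ()

data Origin (l : List Action) (s : Pol) (w : List Action) (κ : Action) (r : List Action) : Set where
  dual-of : ∀ w₀ κ₀ r₀ → l ≡ w₀ ++ κ₀ ∷ r₀ → w ≡ bar w₀ → κ ≡ flipAct κ₀ →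
            r ≡ bar r₀ ++ daimonIfPositive s → Origin l s w κ r
  added-daimon : s ≡ + → κ ≡ daimon → r ≡ [] → Origin l s w κ r

origin : ∀ l s w κ r → bar l ++ daimonIfPositive s ≡ w ++ κ ∷ r → Origin l s w κ r
origin []      s w       κ r eq with daimonIfPositive-split s w κ r eq
... | s≡+ , κ≡daimon , r≡[] = added-daimon s≡+ κ≡daimon r≡[]
origin (x ∷ l) s []      κ r eq =
  dual-of [] x l refl refl (sym (proj₁ (∷-injective eq))) (sym (proj₂ (∷-injective eq)))
origin (x ∷ l) s (y ∷ w) κ r eq with origin l s w κ r (proj₂ (∷-injective eq))
... | dual-of w₀ κ₀ r₀ l≡ w≡ κ≡ r≡ =
  dual-of (x ∷ w₀) κ₀ r₀ (cong (x ∷_) l≡) (cong₂ _∷_ (sym (proj₁ (∷-injective eq))) w≡) κ≡ r≡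
... | added-daimon s≡+ κ≡daimon r≡[] = added-daimon s≡+ κ≡daimon r≡[]

properAddrs-dual : ∀ l s → properAddrs (bar l ++ daimonIfPositive s) ≡ properAddrs l
properAddrs-dual []              + = refl
properAddrs-dual []              - = refl
properAddrs-dual (act _ ζ _ ∷ l) s = cong (ζ ∷_) (properAddrs-dual l s)
properAddrs-dual (daimon ∷ l)    s = properAddrs-dual l s

dual-starts-negative : ∀ l e → (∀ x r → l ≡ x ∷ r → Proper x) → StartsWith + l →
  StartsWith - (bar l ++ e)
dual-starts-negative (x ∷ r) e proper x⁺ =
  trans (polOf-flipAct x (proper x r refl)) (cong flipPol x⁺)

address-mem : ∀ w q ζ K r → ζ ∈ properAddrs (w ++ act q ζ K ∷ r)
address-mem []              q ζ K r = here refl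
address-mem (act _ _ _ ∷ w) q ζ K r = there (address-mem w q ζ K r)
address-mem (daimon ∷ w)    q ζ K r = address-mem w q ζ K r

module DualPath (ξ : Address) (D : Design) (linked : ∀ c → D c → Linked c)
                (p₀ : List Action) (s : Pol) (ζ : Address) (I : List ℕ)
                (P : PathOf (posBase ξ) D (p₀ ∷ʳ act s ζ I)) where

  p : List Action
  p = p₀ ∷ʳ act s ζ I

  t : List Action
  t = bar p ++ daimonIfPositive s

  open LinkedPath (posBase ξ) D linked p P
  private module P = Path (proj₁ P)

  first-initial : ∀ x r → p ≡ x ∷ r → Initial (posBase ξ) x
  first-initial x r p≡ with P.justified [] x r p≡ (proper-at [] x r p≡)
  ... | inj₁ init = init

  -- every initial action is on ξ, and the first action is, so by distinctness
  -- of addresses no later action is initial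
  only-first-initial : ∀ w κ r → p ≡ w ++ κ ∷ r → Initial (posBase ξ) κ → w ≡ []
  only-first-initial []                 _           _ _  _    = refl
  only-first-initial (daimon ∷ w)       κ           r p≡ _    =
    ⊥-elim (first-initial daimon (w ++ κ ∷ r) p≡)
  only-first-initial (act q₁ ζ₁ K₁ ∷ w) (act q₂ ζ₂ K₂) r p≡ init
    with initial-posBase ξ q₂ ζ₂ K₂ init
       | initial-posBase ξ q₁ ζ₁ K₁ (first-initial _ (w ++ act q₂ ζ₂ K₂ ∷ r) p≡)
  ... | refl , refl | refl , refl
    with subst (λ l → Unique (properAddrs l)) p≡ P.distinct
  ...   | ξ∉rest ∷ _ = ⊥-elim (All.lookup ξ∉rest (address-mem w + ξ K₂ r) refl)

  -- negative actions of t are duals of non-first positive actions of p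
  negatives-linked : NegativesLinked (negBase ξ) t
  negatives-linked w a c r t≡ with origin p s w a (c ∷ r) t≡
  ... | added-daimon _ _ ()
  ... | dual-of w₀ a₀ [] _ _ _ c∷r≡ with daimonIfPositive-split s [] c r (sym c∷r≡)
  ...   | _ , refl , _ = λ ()
  negatives-linked w a c r t≡ | dual-of w₀ a₀ (c₀ ∷ r₀) p≡ _ refl c∷r≡
    with proj₁ (∷-injective c∷r≡)
  ... | refl = λ c⁻ → not-initial , justifies-flip a₀ c₀
        (positive-justified-by-previous w₀ a₀ c₀ r₀ p≡ (c₀-positive c⁻))
    where
    p≡' : p ≡ (w₀ ∷ʳ a₀) ++ c₀ ∷ r₀
    p≡' = trans p≡ (snoc-split w₀ a₀ (c₀ ∷ r₀))
    c₀-proper : Proper c₀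
    c₀-proper = proper-at (w₀ ∷ʳ a₀) c₀ r₀ p≡'
    c₀-positive : polOf (flipAct c₀) ≡ - → polOf c₀ ≡ +
    c₀-positive c⁻ = flipPol-injective (trans (sym (polOf-flipAct c₀ c₀-proper)) c⁻)
    not-initial : ¬ Initial (negBase ξ) (flipAct c₀)
    not-initial init = snoc-nonempty w₀ a₀
      (only-first-initial (w₀ ∷ʳ a₀) c₀ r₀ p≡' (initial-unflip ξ c₀ init))

  -- consecutive dual actions alternate as in p; the added daimon follows a
  -- negative action, the dual of the positive last action of p
  alternating : Alternating t
  alternating w a c r t≡ with origin p s w a (c ∷ r) t≡
  ... | added-daimon _ _ ()
  ... | dual-of w₀ a₀ [] p≡ _ refl c∷r≡ with daimonIfPositive-split s [] c r (sym c∷r≡)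
  ...   | refl , refl , _ with ∷ʳ-injectiveʳ w₀ p₀ (sym p≡)
  ...     | refl = λ ()
  alternating w a c r t≡ | dual-of w₀ a₀ (c₀ ∷ r₀) p≡ _ refl c∷r≡
    with proj₁ (∷-injective c∷r≡)
  ... | refl = λ same-pol → P.alternating w₀ a₀ c₀ r₀ p≡ (flipPol-injective
        (trans (sym (polOf-flipAct a₀ a₀-proper)) (trans same-pol (polOf-flipAct c₀ c₀-proper))))
    where
    a₀-proper : Proper a₀
    a₀-proper = proper-at w₀ a₀ (c₀ ∷ r₀) p≡
    c₀-proper : Proper c₀
    c₀-proper = proper-at (w₀ ∷ʳ a₀) c₀ r₀ (trans p≡ (snoc-split w₀ a₀ (c₀ ∷ r₀)))

  -- justifiers and initiality transfer from p; the added daimon needs none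
  justified : Justified (negBase ξ) t
  justified w κ r t≡ κ-proper with origin p s w κ r t≡
  ... | added-daimon _ refl _ = ⊥-elim κ-proper
  ... | dual-of w₀ κ₀ r₀ p≡ refl refl _ with P.justified w₀ κ₀ r₀ p≡ (proper-unflip κ₀ κ-proper)
  ...   | inj₁ init    = inj₁ (initial-flip ξ κ₀ init)
  ...   | inj₂ earlier = inj₂ (map⁺ (Any.map (λ {a} → justifies-flip a κ₀) earlier))

  distinct : DistinctAddrs t
  distinct = subst Unique (sym (properAddrs-dual p s)) P.distinct

  -- p has no daimon, so the only daimon of t is the added final one
  daimon-last : DaimonLast t
  daimon-last w r t≡ with origin p s w daimon r t≡
  ... | added-daimon _ _ r≡[] = r≡[]
  ... | dual-of w₀ κ₀ r₀ p≡ _ daimon≡ _ with daimon-unflip κ₀ (sym daimon≡)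
  ...   | refl = ⊥-elim (daimon-free w₀ r₀ p≡)

  starts-negative : StartsWith - t
  starts-negative = dual-starts-negative p _ (proper-at []) (P.positiveStart refl)

  -- since t is its own view on prefixes, justifiers of positive actions are in the view
  positive-justifier-in-view : ∀ w κ r → t ≡ w ++ κ ∷ r → Proper κ → polOf κ ≡ + →
    ¬ Initial (negBase ξ) κ → Any (λ a → Justifies a κ) (view (negBase ξ) w)
  positive-justifier-in-view w κ r t≡ κ-proper _ ¬init
    rewrite view-prefix-self (negBase ξ) t negatives-linked w (κ ∷ r) t≡
    with justified w κ r t≡ κ-proper
  ... | inj₁ init    = ⊥-elim (¬init init)
  ... | inj₂ earlier = earlier

  chronicle : Chronicle (negBase ξ) t
  chronicle = record
    { startsWithBasePol  = starts-negative
    ; alternating        = alternating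
    ; justified          = justified
    ; negJustifiedByPrev = λ w a κ r t≡ _ κ⁻ _ → proj₂ (negatives-linked w a κ r t≡ κ⁻)
    ; distinct           = distinct
    ; daimonLast         = daimon-last
    }

  path : Path (negBase ξ) t
  path = record
    { alternating        = alternating
    ; justified          = justified
    ; posJustifierInView = positive-justifier-in-view
    ; distinct           = distinct
    ; daimonLast         = daimon-last
    ; positiveStart      = λ ()
    }

dual-of-linked-path : ∀ ξ D → (∀ c → D c → Linked c) → ∀ p → PathOf (posBase ξ) D p →
  Chronicle (negBase ξ) (tilde p) × Path (negBase ξ) (tilde p)
dual-of-linked-path ξ D linked p P with initLast p
... | []              = ⊥-elim (Path.positiveStart (proj₁ P) refl)
... | p₀ ∷ʳ′ daimon    = ⊥-elim (LinkedPath.daimon-free (posBase ξ) D linked _ P p₀ [] refl)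
... | p₀ ∷ʳ′ act s ζ I =
  subst (Chronicle (negBase ξ)) (sym tilde≡) chronicle , subst (Path (negBase ξ)) (sym tilde≡) path
  where
  open DualPath ξ D linked p₀ s ζ I P
  tilde≡ : tilde (p₀ ∷ʳ act s ζ I) ≡ t
  tilde≡ = tilde-last p₀ s ζ I

mainTheorem16 : (ξ : Address) (n : ℕ) (as : Vec ℕ n) (p : List Action) →
    PathOf (posBase ξ) (ListDesign (toList as) ξ) p →
    Chronicle (negBase ξ) (tilde p) × Path (negBase ξ) (tilde p)
mainTheorem16 ξ n as = dual-of-linked-path ξ (ListDesign (toList as) ξ) (listDesign-linked (toList as) ξ)
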